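{- Let $A=(Q,R,F)$ be an RNNA, regarded as the coalgebra $c\colon Q\to2\times(\mathcal{P}_{\mathsf{ufs}}Q)^{\mathbb{A}}\times[\mathbb{A}](\mathcal{P}_{\mathsf{ufs}}Q)$, $c(q)=(b_q,\,a\mapsto\{q':q\xrightarrow{a}q'\},\,\langle d\rangle\{q':q\xrightarrow{|d}q'\})$ with $b_q=1$ iff $q\in F$ and $d$ any name fresh for $q$, for the functor $GX=2\times X^{\mathbb{A}}\times[\mathbb{A}]X$. Let $c^\sharp\colon\mathcal{P}_{\mathsf{ufs}}Q\to G\mathcal{P}_{\mathsf{ufs}}Q$ be its generalized determinization, $c^\sharp(S)=(b,\,a\mapsto\bigcup_{s\in S}\{q':s\xrightarrow{a}q'\},\,\langle d\rangle\bigcup_{s\in S}\{q':s\xrightarrow{|d}q'\})$ with $b=1$ iff $S\cap F\ne\emptyset$ and $d$ fresh for $S$. Let $h$ be the unique $G$-coalgebra homomorphism from $(\mathcal{P}_{\mathsf{ufs}}Q,c^\sharp)$ to the terminal $G$-coalgebra $(\mathcal{P}_{\mathsf{fs}}(\bar{\mathbb{A}}^*/{=_\alpha}),\tau)$, where $\tau(S)=(b_S,\,a\mapsto\{[w]_\alpha:[aw]_\alpha\in S\},\,\langle d\rangle\{[w]_\alpha:[{|}d\,w]_\alpha\in S\})$ with $b_S=1$ iff $[\varepsilon]_\alpha\in S$ and $d$ fresh for $S$. Then for every state $q$, the coalgebraic language semantics $h(\{q\})$ is the bar language accepted by $q$.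
   Context: Fix a countably infinite set $\mathbb{A}$ of names; a nominal set is a set with an action of the finite permutations of $\mathbb{A}$ in which every element $x$ has a finite support with least support $\mathrm{supp}(x)$; $d$ is fresh for $x$ if $d\notin\mathrm{supp}(x)$; orbit-finite means finitely many orbits; $\mathsf{Nom}$ is the category of nominal sets and equivariant maps, $X^{\mathbb{A}}$ the exponential, $2=\{0,1\}$. $\mathcal{P}_{\mathsf{fs}}X$ (resp. $\mathcal{P}_{\mathsf{ufs}}X$) is the nominal set of finitely supported (resp. uniformly finitely supported, i.e. $\bigcup_{x\in S}\mathrm{supp}(x)$ finite) subsets. $[\mathbb{A}]X$ is the quotient of $\mathbb{A}\times X$ by $(a,x)\sim(b,y)$ iff $(a\,e)\cdot x=(b\,e)\cdot y$ for a fresh $e$, classes $\langle a\rangle x$. Bar strings are words over $\bar{\mathbb{A}}=\mathbb{A}\cup\{{|}a:a\in\mathbb{A}\}$; $=_\alpha$ is the least equivalence with $x\,{|}a\,v=_\alpha x\,{|}b\,w$ whenever $\langle a\rangle v=\langle b\rangle w$; $[w]_\alpha$ is the class. An RNNA $(Q,R,F)$ consists of an orbit-finite nominal set $Q$, an equivariant $R\subseteq Q\times\bar{\mathbb{A}}\times Q$ (write $q\xrightarrow{\sigma}q'$) and an equivariant $F\subseteq Q$, such that (a) if $q\xrightarrow{|a}q'$ and $\langle a\rangle q'=\langle b\rangle q''$ then $q\xrightarrow{|b}q''$, and (b) for each $q$ the sets $\{(a,q'):q\xrightarrow{a}q'\}$ and $\{\langle a\rangle q':q\xrightarrow{|a}q'\}$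 are finite. A state accepts $w=\sigma_1\cdots\sigma_n$ if there is a run $q\xrightarrow{\sigma_1}\cdots\xrightarrow{\sigma_n}q_n$ with $q_n\in F$; its bar language is $\{[w]_\alpha:q\text{ accepts }w\}$. The determinization $c^\sharp$ is the homomorphic extension of $c$ to the free $\mathcal{P}_{\mathsf{ufs}}$-algebra $\mathcal{P}_{\mathsf{ufs}}Q$ with respect to the canonical $\mathcal{P}_{\mathsf{ufs}}$-algebra structure on $G\mathcal{P}_{\mathsf{ufs}}Q$, which yields the displayed formula. -}

module Defs where

open import Data.Nat using (ℕ; _≟_)
open import Data.Product using (Σ; ∃; _×_; _,_; proj₁; proj₂)
open import Data.List using (List; []; _∷_; _++_; reverse)
open import Data.List.Membership.Propositional using (_∈_; _∉_)
open import Data.List.Relation.Unary.Any using (Any)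
open import Relation.Binary.PropositionalEquality using (_≡_; _≢_)
open import Relation.Binary.Structures using (IsEquivalence)
open import Relation.Nullary using (yes; no; ¬_)
open import Function.Bundles using (_⇔_)

𝔸 : Set
𝔸 = ℕ

swap : 𝔸 → 𝔸 → 𝔸 → 𝔸
swap a b c with c ≟ a
... | yes _ = b
... | no _ with c ≟ b
...   | yes _ = a
...   | no _ = c

-- A finite permutation, presented as a composite of transpositions:
-- perm ((a , b) ∷ π) = (a b) ∘ perm π.  Every finite permutation arises so.
Perm : Set
Perm = List (𝔸 × 𝔸)

perm : Perm → 𝔸 → 𝔸
perm [] c = c
perm ((a , b) ∷ π) c = swap a b (perm π c)

-- inverse permutation (transpositions are involutions)
inv : Perm → Perm
inv = reverse

Fixes : Perm → List 𝔸 → Set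
Fixes π A = ∀ a → a ∈ A → perm π a ≡ a

-- Nominal sets (carrier a setoid, so that quotients are available)

record Nominal : Set₁ where
  field
    Carrier  : Set
    _≈_      : Carrier → Carrier → Set
    ≈-equiv  : IsEquivalence _≈_
    act      : Perm → Carrier → Carrier
    act-cong : ∀ π {x y} → x ≈ y → act π x ≈ act π y
    act-id   : ∀ x → act [] x ≈ x
    act-comp : ∀ π σ x → act (π ++ σ) x ≈ act π (act σ x)
    -- the action only depends on the permutation, not its presentation
    act-ext  : ∀ π σ → (∀ a → perm π a ≡ perm σ a) → ∀ x → act π x ≈ act σ x
    finSupp  : ∀ x → ∃ λ (A : List 𝔸) → ∀ π → Fixes π A → act π x ≈ x

module _ (X : Nominal) where
  open Nominal X

  Supports : List 𝔸 → Carrier → Set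
  Supports A x = ∀ π → Fixes π A → act π x ≈ x

  -- d is fresh for x, i.e. d ∉ supp(x) (the least support is the
  -- intersection of all finite supports)
  Fresh : 𝔸 → Carrier → Set
  Fresh d x = ∃ λ (A : List 𝔸) → Supports A x × d ∉ A

  -- ⟨a⟩x = ⟨b⟩y in [𝔸]X : (a e)·x ≈ (b e)·y for some e fresh for (a,x),(b,y)
  AbsEq : 𝔸 → Carrier → 𝔸 → Carrier → Set
  AbsEq a x b y = ∃ λ e → e ≢ a × e ≢ b × Fresh e x × Fresh e y
                    × act ((a , e) ∷ []) x ≈ act ((b , e) ∷ []) y

  OrbitFinite : Set
  OrbitFinite = ∃ λ (xs : List Carrier) → ∀ x →
                  Any (λ y → ∃ λ π → act π y ≈ x) xs

data BarLetter : Set where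
  plain : 𝔸 → BarLetter
  bar   : 𝔸 → BarLetter

BarStr : Set
BarStr = List BarLetter

permL : Perm → BarLetter → BarLetter
permL π (plain a) = plain (perm π a)
permL π (bar a)   = bar (perm π a)

permS : Perm → BarStr → BarStr
permS π [] = []
permS π (σ ∷ w) = permL π σ ∷ permS π w

-- names occurring in a bar string (= its least support)
names : BarStr → List 𝔸
names [] = []
names (plain a ∷ w) = a ∷ names w
names (bar a ∷ w) = a ∷ names w

-- ⟨a⟩v = ⟨b⟩w in [𝔸]Ā*
AbsEqS : 𝔸 → BarStr → 𝔸 → BarStr → Set
AbsEqS a v b w = ∃ λ e → e ≢ a × e ≢ b × e ∉ names v × e ∉ names w
                   × permS ((a , e) ∷ []) v ≡ permS ((b , e) ∷ []) w

data _=α_ : BarStr → BarStr → Set where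
  α-refl  : ∀ {u} → u =α u
  α-sym   : ∀ {u v} → u =α v → v =α u
  α-trans : ∀ {u v w} → u =α v → v =α w → u =α w
  α-step  : ∀ x a v b w → AbsEqS a v b w →
            (x ++ (bar a ∷ v)) =α (x ++ (bar b ∷ w))

record RNNA : Set₁ where
  field
    Q : Nominal
  open Nominal Q public renaming (Carrier to State)
  field
    R       : State → BarLetter → State → Set
    F       : State → Set
    Q-of    : OrbitFinite Q
    R-resp  : ∀ {q₁ q₂ σ q₁' q₂'} → q₁ ≈ q₂ → q₁' ≈ q₂' → R q₁ σ q₁' → R q₂ σ q₂'
    R-equiv : ∀ π {q σ q'} → R q σ q' → R (act π q) (permL π σ) (act π q')
    F-resp  : ∀ {q q'} → q ≈ q' → F q → F q'
    F-equiv : ∀ π {q} → F q → F (act π q)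
    α-inv   : ∀ {q a q' b q''} → R q (bar a) q' → AbsEq Q a q' b q'' → R q (bar b) q''
    fin-free  : ∀ q → ∃ λ (L : List (𝔸 × State)) → ∀ a q' → R q (plain a) q' →
                  Any (λ p → proj₁ p ≡ a × q' ≈ proj₂ p) L
    fin-bound : ∀ q → ∃ λ (L : List (𝔸 × State)) → ∀ a q' → R q (bar a) q' →
                  Any (λ p → AbsEq Q a q' (proj₁ p) (proj₂ p)) L

module _ (A : RNNA) where
  open RNNA A

  Accepts : State → BarStr → Set
  Accepts q [] = F q
  Accepts q (σ ∷ w) = ∃ λ q' → R q σ q' × Accepts q' w

  -- bar language of q, as an α-closed predicate on bar strings
  -- (u ∈ L(q) iff [u]_α = [w]_α for some w accepted by q)
  BarLang : State → BarStr → Set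
  BarLang q u = ∃ λ w → Accepts q w × w =α u

  SubQ : Set₁
  SubQ = State → Set

  _≐_ : SubQ → SubQ → Set
  S ≐ S' = ∀ x → S x ⇔ S' x

  -- S is an element of 𝒫_ufs Q: a (≈-closed) subset such that
  -- ⋃_{x∈S} supp(x) is finite
  IsUFS : SubQ → Set
  IsUFS S = (∀ {x y} → x ≈ y → S x → S y)
          × ∃ λ (B : List 𝔸) → ∀ x → S x → Supports Q B x

  actS : Perm → SubQ → SubQ
  actS π S x = S (act (inv π) x)

  FreshS : 𝔸 → SubQ → Set
  FreshS d S = ∃ λ (B : List 𝔸) → d ∉ B × (∀ π → Fixes π B → actS π S ≐ S)

  singleton : State → SubQ
  singleton q x = x ≈ q

  succFree : 𝔸 → SubQ → SubQ
  succFree a S q' = ∃ λ s → S s × R s (plain a) q'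

  succBound : 𝔸 → SubQ → SubQ
  succBound d S q' = ∃ λ s → S s × R s (bar d) q'

  -- subsets of Ā*/=α represented as predicates on bar strings
  SubL : Set₁
  SubL = BarStr → Set

  _≐L_ : SubL → SubL → Set
  P ≐L P' = ∀ w → P w ⇔ P' w

  HomMap : Set₁
  HomMap = (S : SubQ) → IsUFS S → SubL

  record IsCoalgHom (h : HomMap) : Set₁ where
    field
      -- well defined on 𝒫_ufs Q (independent of representative / proof)
      wd       : ∀ S S' p p' → S ≐ S' → h S p ≐L h S' p'
      -- values are subsets of the quotient Ā*/=α ...
      α-closed : ∀ S p {u v} → u =α v → h S p u → h S p v
      fs       : ∀ S p → ∃ λ (B : List 𝔸) → ∀ π → Fixes π B →
                   ∀ w → h S p (permS π w) ⇔ h S p w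
      equivar  : ∀ π S p p' → h (actS π S) p' ≐L (λ w → h S p (permS (inv π) w))
      hom-fin  : ∀ S p → h S p [] ⇔ (∃ λ q → S q × F q)
      hom-free : ∀ a S p p' → (λ w → h S p (plain a ∷ w)) ≐L h (succFree a S) p'
      -- homomorphism, [𝔸]X-component (d fresh for S; ⟨d⟩X = ⟨d⟩Y iff X = Y)
      hom-bar  : ∀ d S p p' → FreshS d S →
                   (λ w → h S p (bar d ∷ w)) ≐L h (succBound d S) p'

{-# OPTIONS --safe #-}
-- By induction on w, for every uniformly supported S, w ∈ h(S) iff some state of S
-- accepts a bar string α-equivalent to w.  The homomorphism equations of h peel off the first
-- letter and replace S by its set of successors; a bound letter |d is first renamed to a name e
-- fresh for S and w, which is harmless because h(S) is α-closed and bar transitions are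
-- α-invariant.  The nominal content is that successor sets are again uniformly supported:
-- by finite branching, the orbit of a successor s′ of s under the permutations fixing a and
-- supp(s) is finite, and an element with finite Fix(C)-orbit is supported by C, since for a name
-- c ∉ C two of the swaps (c e), e fresh, must collide, so c can be dropped from the support.
module Submission where

open import Defs
open import Data.Empty using (⊥-elim)
open import Data.Fin using (Fin; toℕ) renaming (_<_ to _<ᶠ_)
open import Data.Fin.Properties using (pigeonhole; <⇒≢; toℕ-injective)
open import Data.List using (List; []; _∷_; _++_; reverse; length; lookup)
open import Data.List.Membership.Propositional using (_∈_; _∉_)
open import Data.List.Membership.Propositional.Properties using (∈-++⁺ˡ; ∈-++⁺ʳ; ∈-++⁻)
open import Data.List.Properties using (unfold-reverse)
open import Data.List.Relation.Unary.Any using (Any; here; there; index)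
open import Data.List.Relation.Unary.Any.Properties using (lookup-index)
open import Data.Nat using (suc; pred; _+_; _<_; s≤s; _≟_)
open import Data.List.Membership.DecPropositional _≟_ using (_∈?_)
open import Data.Nat.Properties using (≤-trans; m≤m+n; m≤n+m; n≤1+n; <-irrefl; +-cancelˡ-≡; n<1+n)
open import Data.Product using (∃; _×_; _,_; proj₁; proj₂)
open import Data.Sum using (_⊎_; inj₁; inj₂)
open import Function using (_∘_)
open import Function.Bundles using (_⇔_; mk⇔; Equivalence)
open import Relation.Binary.Bundles using (Setoid)
open import Relation.Binary.PropositionalEquality using (_≡_; _≢_; refl; sym; trans; cong; cong₂; subst; ≢-sym)
open import Relation.Binary.Structures using (IsEquivalence)
open import Relation.Nullary using (yes; no; ¬_; Dec)

-- Transpositions and fresh names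

swap-left : ∀ a b → swap a b a ≡ b
swap-left a b with a ≟ a
... | yes _ = refl
... | no a≢a = ⊥-elim (a≢a refl)

swap-right : ∀ a b → swap a b b ≡ a
swap-right a b with b ≟ a
... | yes b≡a = b≡a
... | no _ with b ≟ b
...   | yes _ = refl
...   | no b≢b = ⊥-elim (b≢b refl)

swap-other : ∀ {a b c} → c ≢ a → c ≢ b → swap a b c ≡ c
swap-other {a} {b} {c} c≢a c≢b with c ≟ a
... | yes c≡a = ⊥-elim (c≢a c≡a)
... | no _ with c ≟ b
...   | yes c≡b = ⊥-elim (c≢b c≡b)
...   | no _ = refl

swap-involutive : ∀ a b c → swap a b (swap a b c) ≡ c
swap-involutive a b c = by-cases (c ≟ a) (c ≟ b)
  where
  by-cases : Dec (c ≡ a) → Dec (c ≡ b) → swap a b (swap a b c) ≡ c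
  by-cases (yes refl) _ = trans (cong (swap c b) (swap-left c b)) (swap-right c b)
  by-cases (no _) (yes refl) = trans (cong (swap a c) (swap-right a c)) (swap-left a c)
  by-cases (no c≢a) (no c≢b) = trans (cong (swap a b) (swap-other c≢a c≢b)) (swap-other c≢a c≢b)

swap-comm : ∀ a b c → swap a b c ≡ swap b a c
swap-comm a b c = by-cases (c ≟ a) (c ≟ b)
  where
  by-cases : Dec (c ≡ a) → Dec (c ≡ b) → swap a b c ≡ swap b a c
  by-cases (yes refl) (yes refl) = refl
  by-cases (yes refl) (no _) = trans (swap-left c b) (sym (swap-right b c))
  by-cases (no _) (yes refl) = trans (swap-right a c) (sym (swap-left c a))
  by-cases (no c≢a) (no c≢b) = trans (swap-other c≢a c≢b) (sym (swap-other c≢b c≢a))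

swap-through : ∀ d e f a → a ≢ e → a ≢ f → swap d f a ≡ swap e f (swap d e a)
swap-through d e f a a≢e a≢f = by-cases (a ≟ d)
  where
  by-cases : Dec (a ≡ d) → swap d f a ≡ swap e f (swap d e a)
  by-cases (yes refl) = trans (swap-left a f) (sym (trans (cong (swap e f) (swap-left a e)) (swap-left e f)))
  by-cases (no a≢d) = trans (swap-other a≢d a≢f)
                        (sym (trans (cong (swap e f) (swap-other a≢d a≢e)) (swap-other a≢e a≢f)))

swap-conjugate : ∀ {e e₁ g} → e ≢ e₁ → e ≢ g → e₁ ≢ g → ∀ a →
                 swap e₁ g (swap e e₁ a) ≡ swap e g (swap e₁ g a)
swap-conjugate {e} {e₁} {g} e≢e₁ e≢g e₁≢g a = by-cases (a ≟ e) (a ≟ e₁) (a ≟ g)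
  where
  e₁≢e : e₁ ≢ e
  e₁≢e e₁≡e = e≢e₁ (sym e₁≡e)
  by-cases : Dec (a ≡ e) → Dec (a ≡ e₁) → Dec (a ≡ g) →
             swap e₁ g (swap e e₁ a) ≡ swap e g (swap e₁ g a)
  by-cases (yes refl) _ _ =
    trans (cong (swap e₁ g) (swap-left a e₁)) (trans (swap-left e₁ g)
      (sym (trans (cong (swap a g) (swap-other e≢e₁ e≢g)) (swap-left a g))))
  by-cases (no _) (yes refl) _ =
    trans (cong (swap a g) (swap-right e a)) (trans (swap-other e≢e₁ e≢g)
      (sym (trans (cong (swap e g) (swap-left a g)) (swap-right e g))))
  by-cases (no a≢e) (no a≢e₁) (yes refl) =
    trans (cong (swap e₁ a) (swap-other a≢e a≢e₁)) (trans (swap-right e₁ a)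
      (sym (trans (cong (swap e a) (swap-right e₁ a)) (swap-other e₁≢e e₁≢g))))
  by-cases (no a≢e) (no a≢e₁) (no a≢g) =
    trans (cong (swap e₁ g) (swap-other a≢e a≢e₁)) (trans (swap-other a≢e₁ a≢g)
      (sym (trans (cong (swap e g) (swap-other a≢e₁ a≢g)) (swap-other a≢e a≢g))))

perm-++ : ∀ π σ a → perm (π ++ σ) a ≡ perm π (perm σ a)
perm-++ [] σ a = refl
perm-++ ((u , v) ∷ π) σ a = cong (swap u v) (perm-++ π σ a)

perm-inverseˡ : ∀ π a → perm (inv π) (perm π a) ≡ a
perm-inverseˡ [] a = refl
perm-inverseˡ ((u , v) ∷ π) a rewrite unfold-reverse (u , v) π
  | perm-++ (reverse π) ((u , v) ∷ []) (swap u v (perm π a))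
  | swap-involutive u v (perm π a) = perm-inverseˡ π a

perm-inverseʳ : ∀ π a → perm π (perm (inv π) a) ≡ a
perm-inverseʳ [] a = refl
perm-inverseʳ ((u , v) ∷ π) a rewrite unfold-reverse (u , v) π
  | perm-++ (reverse π) ((u , v) ∷ []) a
  | perm-inverseʳ π (swap u v a) = swap-involutive u v a

perm-injective : ∀ π {a b} → perm π a ≡ perm π b → a ≡ b
perm-injective π {a} {b} eq =
  trans (sym (perm-inverseˡ π a)) (trans (cong (perm (inv π)) eq) (perm-inverseˡ π b))

fresh : List 𝔸 → 𝔸
fresh [] = 0
fresh (a ∷ as) = suc (a + fresh as)

∈⇒<fresh : ∀ {a as} → a ∈ as → a < fresh as
∈⇒<fresh {as = b ∷ bs} (here refl) = s≤s (m≤m+n b (fresh bs))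
∈⇒<fresh {as = b ∷ bs} (there a∈bs) = ≤-trans (∈⇒<fresh a∈bs) (≤-trans (m≤n+m (fresh bs) b) (n≤1+n _))

fresh-∉ : ∀ as → fresh as ∉ as
fresh-∉ as p = <-irrefl refl (∈⇒<fresh p)

fresh+-∉ : ∀ as n → fresh as + n ∉ as
fresh+-∉ as n p = <-irrefl refl (≤-trans (∈⇒<fresh p) (m≤m+n (fresh as) n))

_⇄_ : 𝔸 → 𝔸 → Perm
a ⇄ b = (a , b) ∷ []

-- Nominal sets

module NominalSet (X : Nominal) where
  open Nominal X
  module ≈ = IsEquivalence ≈-equiv

  setoid : Setoid _ _
  setoid = record { isEquivalence = ≈-equiv }

  open import Relation.Binary.Reasoning.Setoid setoid

  SupportedBy : (𝔸 → Set) → Carrier → Set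
  SupportedBy P x = ∀ π → (∀ a → P a → perm π a ≡ a) → act π x ≈ x

  supportedBy-mono : ∀ {P P′ x} → (∀ a → P a → P′ a) → SupportedBy P x → SupportedBy P′ x
  supportedBy-mono P⊆P′ supp π fix = supp π (λ a Pa → fix a (P⊆P′ a Pa))

  act-agree : ∀ {P x} π σ → SupportedBy P x → (∀ a → P a → perm π a ≡ perm σ a) →
              act π x ≈ act σ x
  act-agree {P} {x} π σ supp π≗σ = begin
    act π x                    ≈⟨ act-ext π (σ ++ (inv σ ++ π)) π≗σσ⁻¹π x ⟩
    act (σ ++ (inv σ ++ π)) x  ≈⟨ act-comp σ (inv σ ++ π) x ⟩
    act σ (act (inv σ ++ π) x) ≈⟨ act-cong σ (supp (inv σ ++ π) σ⁻¹π-fixes) ⟩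
    act σ x                    ∎
    where
    π≗σσ⁻¹π : ∀ a → perm π a ≡ perm (σ ++ (inv σ ++ π)) a
    π≗σσ⁻¹π a = sym (trans (perm-++ σ (inv σ ++ π) a)
                  (trans (cong (perm σ) (perm-++ (inv σ) π a)) (perm-inverseʳ σ (perm π a))))
    σ⁻¹π-fixes : ∀ a → P a → perm (inv σ ++ π) a ≡ a
    σ⁻¹π-fixes a Pa = trans (perm-++ (inv σ) π a)
                        (trans (cong (perm (inv σ)) (π≗σ a Pa)) (perm-inverseˡ σ a))

  act-∷ : ∀ t σ x → act (t ∷ σ) x ≈ act (t ∷ []) (act σ x)
  act-∷ t σ x = act-comp (t ∷ []) σ x

  swap-swap : ∀ a b x → act (a ⇄ b) (act (a ⇄ b) x) ≈ x
  swap-swap a b x = begin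
    act (a ⇄ b) (act (a ⇄ b) x) ≈⟨ act-∷ (a , b) (a ⇄ b) x ⟨
    act ((a , b) ∷ a ⇄ b) x     ≈⟨ act-ext ((a , b) ∷ a ⇄ b) [] (swap-involutive a b) x ⟩
    act [] x                    ≈⟨ act-id x ⟩
    x                           ∎

  swap-cancel : ∀ a b {x y} → act (a ⇄ b) x ≈ act (a ⇄ b) y → x ≈ y
  swap-cancel a b {x} {y} eq = begin
    x                           ≈⟨ swap-swap a b x ⟨
    act (a ⇄ b) (act (a ⇄ b) x) ≈⟨ act-cong (a ⇄ b) eq ⟩
    act (a ⇄ b) (act (a ⇄ b) y) ≈⟨ swap-swap a b y ⟩
    y                           ∎

  swap-fresh-fixes : ∀ {A x a b} → Supports X A x → a ∉ A → b ∉ A → act (a ⇄ b) x ≈ x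
  swap-fresh-fixes supp a∉A b∉A = supp _ λ c c∈A →
    swap-other (λ { refl → a∉A c∈A }) (λ { refl → b∉A c∈A })

  swap-supports : ∀ {A x} d e → Supports X A x → Supports X (d ∷ e ∷ A) (act (d ⇄ e) x)
  swap-supports {A} {x} d e supp σ fix = begin
    act σ (act (d ⇄ e) x) ≈⟨ act-comp σ (d ⇄ e) x ⟨
    act (σ ++ d ⇄ e) x    ≈⟨ act-agree (σ ++ d ⇄ e) (d ⇄ e) supp agree ⟩
    act (d ⇄ e) x         ∎
    where
    swapped∈ : ∀ {a} → a ∈ A → Dec (a ≡ d) → Dec (a ≡ e) → swap d e a ∈ d ∷ e ∷ A
    swapped∈ {a} _ (yes refl) _ = there (here (swap-left a e))
    swapped∈ {a} _ (no _) (yes refl) = here (swap-right d a)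
    swapped∈ {a} a∈A (no a≢d) (no a≢e) = there (there (subst (_∈ A) (sym (swap-other a≢d a≢e)) a∈A))
    agree : ∀ a → a ∈ A → perm (σ ++ d ⇄ e) a ≡ perm (d ⇄ e) a
    agree a a∈A = trans (perm-++ σ (d ⇄ e) a) (fix (swap d e a) (swapped∈ a∈A (a ≟ d) (a ≟ e)))

  -- π agrees on P with (f k) ∘ (c f), where k = π c; and (f k) fixes x unless k = c.
  support-remove : ∀ {P x} c f → SupportedBy P x → act (c ⇄ f) x ≈ x → ¬ P f → f ≢ c →
                   SupportedBy (λ a → P a × a ≢ c) x
  support-remove {P} {x} c f supp cf-fixes ¬Pf f≢c π fix = fixes-x (k ≟ c)
    where
    k = perm π c
    π≗fk∘cf : ∀ a → P a → perm π a ≡ swap f k (swap c f a)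
    π≗fk∘cf a Pa = by-cases (a ≟ c)
      where
      by-cases : Dec (a ≡ c) → perm π a ≡ swap f k (swap c f a)
      by-cases (yes refl) = sym (trans (cong (swap f k) (swap-left c f)) (swap-left f k))
      by-cases (no a≢c) = trans (fix a (Pa , a≢c))
                            (sym (trans (cong (swap f k) (swap-other a≢c a≢f)) (swap-other a≢f a≢k)))
        where
        a≢f : a ≢ f
        a≢f refl = ¬Pf Pa
        a≢k : a ≢ k
        a≢k a≡k = a≢c (perm-injective π (trans (fix a (Pa , a≢c)) a≡k))
    πx≈fkx : act π x ≈ act (f ⇄ k) x
    πx≈fkx = begin
      act π x                   ≈⟨ act-agree π ((f , k) ∷ c ⇄ f) supp π≗fk∘cf ⟩
      act ((f , k) ∷ c ⇄ f) x   ≈⟨ act-∷ (f , k) (c ⇄ f) x ⟩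
      act (f ⇄ k) (act (c ⇄ f) x) ≈⟨ act-cong (f ⇄ k) cf-fixes ⟩
      act (f ⇄ k) x             ∎
    fixes-x : Dec (k ≡ c) → act π x ≈ x
    fixes-x (yes k≡c) = begin
      act π x       ≈⟨ πx≈fkx ⟩
      act (f ⇄ k) x ≈⟨ act-ext (f ⇄ k) (c ⇄ f) (λ a → trans (cong (λ z → swap f z a) k≡c) (swap-comm f c a)) x ⟩
      act (c ⇄ f) x ≈⟨ cf-fixes ⟩
      x             ∎
    fixes-x (no k≢c) = ≈.trans πx≈fkx (supp (f ⇄ k) fk-fixes)
      where
      ¬Pk : ¬ P k
      ¬Pk Pk = k≢c (perm-injective π (fix k (Pk , k≢c)))
      fk-fixes : ∀ a → P a → swap f k a ≡ a
      fk-fixes a Pa = swap-other (λ { refl → ¬Pf Pa }) (λ { refl → ¬Pk Pa })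

  -- (c e) ∘ (c e′) agrees with (c e′) on D.
  swap-collision : ∀ {D x c e e′} → Supports X D x → e ∉ D → e′ ∉ D → e ≢ e′ → e′ ≢ c →
                   act (c ⇄ e) x ≈ act (c ⇄ e′) x → act (c ⇄ e′) x ≈ x
  swap-collision {D} {x} {c} {e} {e′} supp e∉D e′∉D e≢e′ e′≢c collide = begin
    act (c ⇄ e′) x                ≈⟨ act-agree ((c , e) ∷ c ⇄ e′) (c ⇄ e′) supp agree ⟨
    act ((c , e) ∷ c ⇄ e′) x      ≈⟨ act-∷ (c , e) (c ⇄ e′) x ⟩
    act (c ⇄ e) (act (c ⇄ e′) x)  ≈⟨ act-cong (c ⇄ e) collide ⟨
    act (c ⇄ e) (act (c ⇄ e) x)   ≈⟨ swap-swap c e x ⟩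
    x                             ∎
    where
    agree : ∀ a → a ∈ D → swap c e (swap c e′ a) ≡ swap c e′ a
    agree a a∈D = by-cases (a ≟ c)
      where
      by-cases : Dec (a ≡ c) → swap c e (swap c e′ a) ≡ swap c e′ a
      by-cases (yes refl) = trans (cong (swap a e) (swap-left a e′))
        (trans (swap-other e′≢c (λ e′≡e → e≢e′ (sym e′≡e))) (sym (swap-left a e′)))
      by-cases (no a≢c) = trans (cong (swap c e) a-fixed)
        (trans (swap-other a≢c (λ { refl → e∉D a∈D })) (sym a-fixed))
        where
        a-fixed : swap c e′ a ≡ a
        a-fixed = swap-other a≢c (λ { refl → e′∉D a∈D })

  swap-conjugate-act : ∀ {e e₁ g} → e ≢ e₁ → e ≢ g → e₁ ≢ g → ∀ z →
                       act (e₁ ⇄ g) (act (e ⇄ e₁) z) ≈ act (e ⇄ g) (act (e₁ ⇄ g) z)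
  swap-conjugate-act {e} {e₁} {g} e≢e₁ e≢g e₁≢g z = begin
    act (e₁ ⇄ g) (act (e ⇄ e₁) z) ≈⟨ act-∷ (e₁ , g) (e ⇄ e₁) z ⟨
    act ((e₁ , g) ∷ e ⇄ e₁) z     ≈⟨ act-ext _ _ (swap-conjugate e≢e₁ e≢g e₁≢g) z ⟩
    act ((e , g) ∷ e₁ ⇄ g) z      ≈⟨ act-∷ (e , g) (e₁ ⇄ g) z ⟩
    act (e ⇄ g) (act (e₁ ⇄ g) z)  ∎

  absEq-rename : ∀ {A x} d e → Supports X A x → e ≢ d → e ∉ A → AbsEq X d x e (act (d ⇄ e) x)
  absEq-rename {A} {x} d e supp e≢d e∉A =
    e₁ , (λ e₁≡d → e₁∉ (here e₁≡d)) , (λ e₁≡e → e₁∉ (there (here e₁≡e))) ,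
    (A , supp , λ e₁∈A → e₁∉ (there (there e₁∈A))) , (d ∷ e ∷ A , swap-supports d e supp , e₁∉) ,
    (begin
      act (d ⇄ e₁) x                ≈⟨ act-agree (d ⇄ e₁) ((e , e₁) ∷ d ⇄ e) supp through ⟩
      act ((e , e₁) ∷ d ⇄ e) x      ≈⟨ act-∷ (e , e₁) (d ⇄ e) x ⟩
      act (e ⇄ e₁) (act (d ⇄ e) x)  ∎)
    where
    e₁ = fresh (d ∷ e ∷ A)
    e₁∉ = fresh-∉ (d ∷ e ∷ A)
    through : ∀ a → a ∈ A → swap d e₁ a ≡ swap e e₁ (swap d e a)
    through a a∈A = swap-through d e e₁ a (λ { refl → e∉A a∈A }) (λ { refl → e₁∉ (there (there a∈A)) })

  -- Conjugating by (e₁ g), which fixes u and y, moves the witness e₁ of AbsEq to any fresh g.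
  absEq-fresh : ∀ {e u b y} → AbsEq X e u b y →
                ∃ λ avoid → ∀ g → g ∉ avoid → act (e ⇄ g) u ≈ act (b ⇄ g) y
  absEq-fresh {e} {u} {b} {y} (e₁ , e₁≢e , e₁≢b , (Au , supp-u , e₁∉Au) , (Ay , supp-y , e₁∉Ay) , eq) =
    avoid , λ g g∉ → begin
      act (e ⇄ g) u                 ≈⟨ act-cong (e ⇄ g) (swap-fresh-fixes supp-u e₁∉Au (g∉ ∘ Au⊆)) ⟨
      act (e ⇄ g) (act (e₁ ⇄ g) u)  ≈⟨ swap-conjugate-act (≢-sym e₁≢e) (g∉ ∘ e∈) (g∉ ∘ e₁∈) u ⟨
      act (e₁ ⇄ g) (act (e ⇄ e₁) u) ≈⟨ act-cong (e₁ ⇄ g) eq ⟩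
      act (e₁ ⇄ g) (act (b ⇄ e₁) y) ≈⟨ swap-conjugate-act (≢-sym e₁≢b) (g∉ ∘ b∈) (g∉ ∘ e₁∈) y ⟩
      act (b ⇄ g) (act (e₁ ⇄ g) y)  ≈⟨ act-cong (b ⇄ g) (swap-fresh-fixes supp-y e₁∉Ay (g∉ ∘ Ay⊆)) ⟩
      act (b ⇄ g) y                 ∎
    where
    avoid = e ∷ b ∷ e₁ ∷ Au ++ Ay
    e∈ : ∀ {g} → e ≡ g → g ∈ avoid
    e∈ e≡g = here (sym e≡g)
    b∈ : ∀ {g} → b ≡ g → g ∈ avoid
    b∈ b≡g = there (here (sym b≡g))
    e₁∈ : ∀ {g} → e₁ ≡ g → g ∈ avoid
    e₁∈ e₁≡g = there (there (here (sym e₁≡g)))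
    Au⊆ : ∀ {g} → g ∈ Au → g ∈ avoid
    Au⊆ g∈ = there (there (there (∈-++⁺ˡ g∈)))
    Ay⊆ : ∀ {g} → g ∈ Ay → g ∈ avoid
    Ay⊆ g∈ = there (there (there (∈-++⁺ʳ Au g∈)))

  absEq-functional : ∀ {e u v b y} → AbsEq X e u b y → AbsEq X e v b y → u ≈ v
  absEq-functional {e} p q with absEq-fresh p | absEq-fresh q
  ... | avoid₁ , eq₁ | avoid₂ , eq₂ =
    swap-cancel e g (≈.trans (eq₁ g (g∉ ∘ ∈-++⁺ˡ)) (≈.sym (eq₂ g (g∉ ∘ ∈-++⁺ʳ avoid₁))))
    where
    g = fresh (avoid₁ ++ avoid₂)
    g∉ = fresh-∉ (avoid₁ ++ avoid₂)

  -- Rel u y: u lies in the class represented by y, so orbit says that the Fix(C)-orbit of x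
  -- meets only the finitely many classes of L.
  module FiniteOrbit {Y : Set} (Rel : Carrier → Y → Set)
                     (Rel-functional : ∀ {u v y} → Rel u y → Rel v y → u ≈ v)
                     (C : List 𝔸) (L : List Y) {x : Carrier}
                     (orbit : ∀ σ → Fixes σ C → Any (Rel (act σ x)) L) where

    -- pigeonhole over 1 + length L swaps (c e) with pairwise distinct fresh names e
    fixing-swap : ∀ c → c ∉ C → ∀ D → Supports X D x → ∃ λ f → f ∉ D × f ≢ c × act (c ⇄ f) x ≈ x
    fixing-swap c c∉C D supp = collision (pigeonhole (n<1+n (length L)) class)
      where
      M = c ∷ D ++ C
      e : Fin (suc (length L)) → 𝔸
      e i = fresh M + toℕ i
      e∉M : ∀ i → e i ∉ M
      e∉M i = fresh+-∉ M (toℕ i)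
      e∉D : ∀ i → e i ∉ D
      e∉D i e∈D = e∉M i (there (∈-++⁺ˡ e∈D))
      ce-fixes-C : ∀ i → Fixes (c ⇄ e i) C
      ce-fixes-C i a a∈C = swap-other (λ { refl → c∉C a∈C }) (λ { refl → e∉M i (there (∈-++⁺ʳ D a∈C)) })
      class : Fin (suc (length L)) → Fin (length L)
      class i = index (orbit (c ⇄ e i) (ce-fixes-C i))
      in-class : ∀ i → Rel (act (c ⇄ e i) x) (lookup L (class i))
      in-class i = lookup-index (orbit (c ⇄ e i) (ce-fixes-C i))
      collision : (∃ λ i → ∃ λ j → i <ᶠ j × class i ≡ class j) →
                  ∃ λ f → f ∉ D × f ≢ c × act (c ⇄ f) x ≈ x
      collision (i , j , i<j , same-class) =
        e j , e∉D j , (λ e≡c → e∉M j (here e≡c)) ,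
        swap-collision supp (e∉D i) (e∉D j) e-distinct (λ e≡c → e∉M j (here e≡c))
          (Rel-functional (subst (λ k → Rel _ (lookup L k)) same-class (in-class i)) (in-class j))
        where
        e-distinct : e i ≢ e j
        e-distinct eq = <⇒≢ i<j (toℕ-injective (+-cancelˡ-≡ (fresh M) _ _ eq))

    supported-within : ∀ A → SupportedBy (λ a → a ∈ A ⊎ a ∈ C) x → Supports X C x
    supported-within [] supp = supportedBy-mono (λ { a (inj₂ a∈C) → a∈C }) supp
    supported-within (c ∷ A) supp with c ∈? C
    ... | yes c∈C = supported-within A (supportedBy-mono absorb supp)
      where
      absorb : ∀ a → a ∈ c ∷ A ⊎ a ∈ C → a ∈ A ⊎ a ∈ C
      absorb a (inj₁ (here refl)) = inj₂ c∈C
      absorb a (inj₁ (there a∈A)) = inj₁ a∈A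
      absorb a (inj₂ a∈C) = inj₂ a∈C
    ... | no c∉C = remove-c (fixing-swap c c∉C D supp-D)
      where
      D = (c ∷ A) ++ C
      supp-D : Supports X D x
      supp-D = supportedBy-mono (λ { a (inj₁ a∈cA) → ∈-++⁺ˡ a∈cA ; a (inj₂ a∈C) → ∈-++⁺ʳ (c ∷ A) a∈C }) supp
      remaining : ∀ a → a ∈ D × a ≢ c → a ∈ A ⊎ a ∈ C
      remaining a (a∈D , a≢c) with ∈-++⁻ (c ∷ A) a∈D
      ... | inj₁ (here a≡c) = ⊥-elim (a≢c a≡c)
      ... | inj₁ (there a∈A) = inj₁ a∈A
      ... | inj₂ a∈C = inj₂ a∈C
      remove-c : (∃ λ f → f ∉ D × f ≢ c × act (c ⇄ f) x ≈ x) → Supports X C x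
      remove-c (f , f∉D , f≢c , cf-fixes) =
        supported-within A (supportedBy-mono remaining (support-remove c f supp-D cf-fixes f∉D f≢c))

    supported : Supports X C x
    supported = supported-within (proj₁ (finSupp x)) (supportedBy-mono (λ _ → inj₁) (proj₂ (finSupp x)))

-- Bar strings

permS-++ : ∀ π σ w → permS π (permS σ w) ≡ permS (π ++ σ) w
permS-++ π σ [] = refl
permS-++ π σ (plain a ∷ w) = cong₂ _∷_ (cong plain (sym (perm-++ π σ a))) (permS-++ π σ w)
permS-++ π σ (bar a ∷ w) = cong₂ _∷_ (cong bar (sym (perm-++ π σ a))) (permS-++ π σ w)

permS-ext : ∀ π σ w → (∀ a → a ∈ names w → perm π a ≡ perm σ a) → permS π w ≡ permS σ w
permS-ext π σ [] π≗σ = refl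
permS-ext π σ (plain a ∷ w) π≗σ = cong₂ _∷_ (cong plain (π≗σ a (here refl))) (permS-ext π σ w (λ b → π≗σ b ∘ there))
permS-ext π σ (bar a ∷ w) π≗σ = cong₂ _∷_ (cong bar (π≗σ a (here refl))) (permS-ext π σ w (λ b → π≗σ b ∘ there))

names-permS : ∀ π w {a} → a ∈ names (permS π w) → perm (inv π) a ∈ names w
names-permS π (plain b ∷ w) (here refl) = here (perm-inverseˡ π b)
names-permS π (bar b ∷ w) (here refl) = here (perm-inverseˡ π b)
names-permS π (plain b ∷ w) (there a∈) = there (names-permS π w a∈)
names-permS π (bar b ∷ w) (there a∈) = there (names-permS π w a∈)

length-permS : ∀ π w → length (permS π w) ≡ length w
length-permS π [] = refl
length-permS π (σ ∷ w) = cong suc (length-permS π w)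

∷-=α : ∀ ℓ {u v} → u =α v → (ℓ ∷ u) =α (ℓ ∷ v)
∷-=α ℓ α-refl = α-refl
∷-=α ℓ (α-sym p) = α-sym (∷-=α ℓ p)
∷-=α ℓ (α-trans p q) = α-trans (∷-=α ℓ p) (∷-=α ℓ q)
∷-=α ℓ (α-step x a v b w eq) = α-step (ℓ ∷ x) a v b w eq

bar-rename-=α : ∀ d w e → e ≢ d → e ∉ names w → (bar d ∷ w) =α (bar e ∷ permS (d ⇄ e) w)
bar-rename-=α d w e e≢d e∉w =
  α-step [] d w e (permS (d ⇄ e) w)
    (e₁ , (λ e₁≡d → e₁∉ (here e₁≡d)) , (λ e₁≡e → e₁∉ (there (here e₁≡e))) , e₁∉ ∘ there ∘ there ,
     e₁∉renamed , trans (permS-ext (d ⇄ e₁) ((e , e₁) ∷ d ⇄ e) w through) (sym (permS-++ (e ⇄ e₁) (d ⇄ e) w)))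
  where
  e₁ = fresh (d ∷ e ∷ names w)
  e₁∉ = fresh-∉ (d ∷ e ∷ names w)
  e₁∉renamed : e₁ ∉ names (permS (d ⇄ e) w)
  e₁∉renamed e₁∈ = e₁∉ (there (there (subst (_∈ names w)
    (swap-other (λ e₁≡d → e₁∉ (here e₁≡d)) (λ e₁≡e → e₁∉ (there (here e₁≡e)))) (names-permS (d ⇄ e) w e₁∈))))
  through : ∀ a → a ∈ names w → swap d e₁ a ≡ swap e e₁ (swap d e a)
  through a a∈w = swap-through d e e₁ a (λ { refl → e∉w a∈w }) (λ { refl → e₁∉ (there (there a∈w)) })

-- RNNAs and their coalgebraic semantics

letterName : BarLetter → 𝔸
letterName (plain a) = a
letterName (bar a) = a

permL-fixed : ∀ σ ℓ → perm σ (letterName ℓ) ≡ letterName ℓ → permL σ ℓ ≡ ℓ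
permL-fixed σ (plain a) = cong plain
permL-fixed σ (bar a) = cong bar

module Automaton (A : RNNA) where
  open RNNA A
  open NominalSet Q

  Accepts-equivariant : ∀ π {q} w → Accepts A q w → Accepts A (act π q) (permS π w)
  Accepts-equivariant π [] q∈F = F-equiv π q∈F
  Accepts-equivariant π (ℓ ∷ w) (q′ , r , acc) = act π q′ , R-equiv π r , Accepts-equivariant π w acc

  Accepts-resp : ∀ {q q′} w → q ≈ q′ → Accepts A q w → Accepts A q′ w
  Accepts-resp [] q≈q′ q∈F = F-resp q≈q′ q∈F
  Accepts-resp (ℓ ∷ w) q≈q′ (q₁ , r , acc) = q₁ , R-resp q≈q′ ≈.refl r , acc

  R-fixed : ∀ {B s ℓ s′} → Supports Q B s → R s ℓ s′ → ∀ σ → Fixes σ (letterName ℓ ∷ B) →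
            R s ℓ (act σ s′)
  R-fixed {ℓ = ℓ} {s′} supp r σ fix =
    R-resp (supp σ (λ b → fix b ∘ there)) ≈.refl
      (subst (λ ℓ′ → R (act σ _) ℓ′ (act σ s′)) (permL-fixed σ ℓ (fix (letterName ℓ) (here refl))) (R-equiv σ r))

  successor-supported : ∀ {B s s′} ℓ → Supports Q B s → R s ℓ s′ → Supports Q (letterName ℓ ∷ B) s′
  successor-supported {B} {s} {s′} (plain a) supp r =
    FiniteOrbit.supported Rel Rel-functional (a ∷ B) (proj₁ (fin-free s)) orbit
    where
    Rel : State → 𝔸 × State → Set
    Rel u (b , t) = b ≡ a × u ≈ t
    Rel-functional : ∀ {u v y} → Rel u y → Rel v y → u ≈ v
    Rel-functional (_ , u≈t) (_ , v≈t) = ≈.trans u≈t (≈.sym v≈t)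
    orbit : ∀ σ → Fixes σ (a ∷ B) → Any (Rel (act σ s′)) (proj₁ (fin-free s))
    orbit σ fix = proj₂ (fin-free s) a (act σ s′) (R-fixed supp r σ fix)
  successor-supported {B} {s} {s′} (bar a) supp r =
    FiniteOrbit.supported Rel absEq-functional (a ∷ B) (proj₁ (fin-bound s)) orbit
    where
    Rel : State → 𝔸 × State → Set
    Rel u (b , t) = AbsEq Q a u b t
    orbit : ∀ σ → Fixes σ (a ∷ B) → Any (Rel (act σ s′)) (proj₁ (fin-bound s))
    orbit σ fix = proj₂ (fin-bound s) a (act σ s′) (R-fixed supp r σ fix)

  ufsSupport : ∀ {S} → IsUFS A S → List 𝔸
  ufsSupport (_ , B , _) = B

  successors-ufs : ∀ {S} ℓ → IsUFS A S → IsUFS A (λ s′ → ∃ λ s → S s × R s ℓ s′)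
  successors-ufs ℓ (_ , B , supp) =
    (λ { s′≈s″ (s , s∈S , r) → s , s∈S , R-resp ≈.refl s′≈s″ r }) ,
    letterName ℓ ∷ B , λ { s′ (s , s∈S , r) → successor-supported ℓ (supp s s∈S) r }

  ufs-fresh : ∀ {S e} (p : IsUFS A S) → e ∉ ufsSupport p → FreshS A e S
  ufs-fresh {S} (closed , B , supp) e∉B = B , e∉B , λ π fix x → mk⇔ (moved⇒ π fix x) (⇒moved π fix x)
    where
    moved⇒ : ∀ π → Fixes π B → ∀ x → S (act (inv π) x) → S x
    moved⇒ π fix x π⁻¹x∈S = closed (≈.trans (≈.sym (supp _ π⁻¹x∈S π fix)) ππ⁻¹x≈x) π⁻¹x∈S
      where
      ππ⁻¹x≈x : act π (act (inv π) x) ≈ x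
      ππ⁻¹x≈x = ≈.trans (≈.sym (act-comp π (inv π) x))
        (≈.trans (act-ext (π ++ inv π) [] (λ a → trans (perm-++ π (inv π) a) (perm-inverseʳ π a)) x) (act-id x))
    ⇒moved : ∀ π → Fixes π B → ∀ x → S x → S (act (inv π) x)
    ⇒moved π fix x x∈S = closed (≈.sym (supp x x∈S (inv π) π⁻¹-fix)) x∈S
      where
      π⁻¹-fix : Fixes (inv π) B
      π⁻¹-fix a a∈B = trans (cong (perm (inv π)) (sym (fix a a∈B))) (perm-inverseˡ π a)

  R-bar-rename : ∀ {s d s′ e} → R s (bar d) s′ → e ≢ d → e ∉ proj₁ (finSupp s′) → R s (bar e) (act (d ⇄ e) s′)
  R-bar-rename {d = d} {s′} {e} r e≢d e∉ = α-inv r (absEq-rename d e (proj₂ (finSupp s′)) e≢d e∉)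

module Semantics (A : RNNA) (h : HomMap A) (hom : IsCoalgHom A h) where
  open RNNA A
  open Automaton A
  open IsCoalgHom hom
  open Equivalence

  LangOf : SubQ A → SubL A
  LangOf S w = ∃ λ s → S s × BarLang A s w

  h-bar-rename : ∀ S (p : IsUFS A S) d w e → e ∉ ufsSupport p → e ≢ d → e ∉ names w →
                 h S p (bar d ∷ w) ⇔ h (succBound A e S) (successors-ufs (bar e) p) (permS (d ⇄ e) w)
  h-bar-rename S p d w e e∉S e≢d e∉w = mk⇔
    (λ h∋dw → to (hom-bar′ (permS (d ⇄ e) w)) (α-closed S p renamed h∋dw))
    (λ h∋w′ → α-closed S p (α-sym renamed) (from (hom-bar′ (permS (d ⇄ e) w)) h∋w′))
    where
    hom-bar′ = hom-bar e S p (successors-ufs (bar e) p) (ufs-fresh p e∉S)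
    renamed = bar-rename-=α d w e e≢d e∉w

  LangOf-successors : ∀ {S} ℓ {w} → LangOf (λ s′ → ∃ λ s → S s × R s ℓ s′) w → LangOf S (ℓ ∷ w)
  LangOf-successors ℓ (s′ , (s , s∈S , r) , u , acc , u=w) = s , s∈S , ℓ ∷ u , (s′ , r , acc) , ∷-=α ℓ u=w

  LangOf-=α : ∀ {S u v} → u =α v → LangOf S u → LangOf S v
  LangOf-=α u=v (s , s∈S , w , acc , w=u) = s , s∈S , w , acc , α-trans w=u u=v

  -- the length index makes the recursion through the renamed suffix permS (d ⇄ e) w structural
  h⇒LangOf : ∀ n w → length w ≡ n → ∀ S p → h S p w → LangOf S w
  h⇒LangOf n [] _ S p h∋ε with to (hom-fin S p) h∋ε
  ... | s , s∈S , s∈F = s , s∈S , [] , s∈F , α-refl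
  h⇒LangOf (suc n) (plain a ∷ w) len S p h∋aw =
    LangOf-successors (plain a)
      (h⇒LangOf n w (cong pred len) (succFree A a S) (successors-ufs (plain a) p)
        (to (hom-free a S p (successors-ufs (plain a) p) w) h∋aw))
  h⇒LangOf (suc n) (bar d ∷ w) len S p h∋dw =
    LangOf-=α (α-sym (bar-rename-=α d w e e≢d e∉w))
      (LangOf-successors (bar e)
        (h⇒LangOf n (permS (d ⇄ e) w) (trans (length-permS (d ⇄ e) w) (cong pred len))
          (succBound A e S) (successors-ufs (bar e) p) (to (h-bar-rename S p d w e e∉S e≢d e∉w) h∋dw)))
    where
    avoid = ufsSupport p ++ d ∷ names w
    e = fresh avoid
    e∉S = fresh-∉ avoid ∘ ∈-++⁺ˡ
    e≢d = fresh-∉ avoid ∘ ∈-++⁺ʳ (ufsSupport p) ∘ here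
    e∉w = fresh-∉ avoid ∘ ∈-++⁺ʳ (ufsSupport p) ∘ there

  Accepts⇒h : ∀ n w → length w ≡ n → ∀ S p s → S s → Accepts A s w → h S p w
  Accepts⇒h n [] _ S p s s∈S s∈F = from (hom-fin S p) (s , s∈S , s∈F)
  Accepts⇒h (suc n) (plain a ∷ w) len S p s s∈S (s′ , r , acc) =
    from (hom-free a S p (successors-ufs (plain a) p) w)
      (Accepts⇒h n w (cong pred len) (succFree A a S) (successors-ufs (plain a) p) s′ (s , s∈S , r) acc)
  Accepts⇒h (suc n) (bar d ∷ w) len S p s s∈S (s′ , r , acc) =
    from (h-bar-rename S p d w e e∉S e≢d e∉w)
      (Accepts⇒h n (permS (d ⇄ e) w) (trans (length-permS (d ⇄ e) w) (cong pred len))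
        (succBound A e S) (successors-ufs (bar e) p) (act (d ⇄ e) s′)
        (s , s∈S , R-bar-rename r e≢d e∉s′) (Accepts-equivariant (d ⇄ e) w acc))
    where
    avoid = ufsSupport p ++ d ∷ names w ++ proj₁ (finSupp s′)
    e = fresh avoid
    e∉S = fresh-∉ avoid ∘ ∈-++⁺ˡ
    e≢d = fresh-∉ avoid ∘ ∈-++⁺ʳ (ufsSupport p) ∘ here
    e∉w = fresh-∉ avoid ∘ ∈-++⁺ʳ (ufsSupport p) ∘ there ∘ ∈-++⁺ˡ
    e∉s′ = fresh-∉ avoid ∘ ∈-++⁺ʳ (ufsSupport p) ∘ there ∘ ∈-++⁺ʳ (names w)

  h-language : ∀ S p → _≐L_ A (h S p) (LangOf S)
  h-language S p w = mk⇔ (h⇒LangOf _ w refl S p)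
    λ { (s , s∈S , u , acc , u=w) → α-closed S p u=w (Accepts⇒h _ u refl S p s s∈S acc) }

mainTheorem17 : (A : RNNA) (h : HomMap A) → IsCoalgHom A h →
    ∀ (q : RNNA.State A) (p : IsUFS A (singleton A q)) →
    _≐L_ A (h (singleton A q) p) (BarLang A q)
mainTheorem17 A h hom q p w = mk⇔
  (λ h∋w → singleton-lang (to (h-language (singleton A q) p w) h∋w))
  (λ { (u , acc , u=w) → from (h-language (singleton A q) p w) (q , ≈.refl , u , acc , u=w) })
  where
  open Semantics A h hom
  open NominalSet (RNNA.Q A) using (module ≈)
  open Automaton A using (Accepts-resp)
  open Equivalence
  singleton-lang : LangOf (singleton A q) w → BarLang A q w
  singleton-lang (s , s≈q , u , acc , u=w) = u , Accepts-resp u s≈q acc , u=w
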